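{- Let $H$ be a graph that has a lower bound structure $(L,(x_1,\dots,x_d),(x_1',\dots,x_d'))$ of order $d\geq 3$. Then there exist an inequality gadget $\mathsf{NEQ}(x_i,x_i')$ for every $i\in[d]$, and a compatibility gadget $\mathsf{Comp}(x_i,x_i',x_j,x_j')$ for every distinct $i,j\in[d]$. Furthermore, each of these gadgets has 10 vertices.
   Context: Graphs may have loops; $N(v)$ is the neighborhood of $v$; vertices $u,v$ are incomparable if neither $N(u)\subseteq N(v)$ nor $N(v)\subseteq N(u)$. A lower bound structure of order $d$ in $H$: a set $L\subseteq V(H)$, distinct $x_1,\dots,x_d$, not necessarily distinct $x_1',\dots,x_d'$ with $x_i,x_i'$ incomparable, $\bigcap_i N(x_i)\cap L=\emptyset$, and $\bigcap_i N(y_i)\cap L\ne\emptyset$ for every choice $y_i\in\{x_i,x_i'\}$ with at least one $y_i=x_i'$. A list homomorphism $(F,\mathcal{L})\to H$ for lists $\mathcal{L}\colon V(F)\to 2^{V(H)}$ is an edge-preserving map $\varphi\colon V(F)\to V(H)$ with $\varphi(v)\in\mathcal{L}(v)$. For distinct $x,y\in V(H)$, an inequality gadget $\mathsf{NEQ}(x,y)$ is a graph $F$ with lists $\mathcal{L}$ and designated vertices $u,v$ such that $\mathcal{L}(u)=\mathcal{L}(v)=\{x,y\}$; there are list homomorphisms $\varphi,\psi\colon(F,\mathcal{L})\to H$ with $\varphi(u)=\psi(v)=x$ and $\varphi(v)=\psi(u)=y$; and there is no list homomorphism $\varphi$ with $\varphi(u)=\varphi(v)$. For $a,a',b,b'\in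 V(H)$, a compatibility gadget $\mathsf{Comp}(a,a',b,b')$ is a graph $C$ with lists $\mathcal{L}$ and designated vertices $u,v$ such that $\mathcal{L}(u)=\{a,a'\}$, $\mathcal{L}(v)=\{b,b'\}$; there are list homomorphisms $\varphi,\psi\colon(C,\mathcal{L})\to H$ with $\varphi(u)=a,\varphi(v)=b,\psi(u)=a',\psi(v)=b'$; and no list homomorphism maps $(u,v)$ to $(a,b')$ or to $(a',b)$. -}

module Defs where

open import Data.Nat using (ℕ)
open import Data.Fin using (Fin)
open import Data.Bool using (Bool; true; false; T)
open import Data.Product using (Σ; ∃; _×_; _,_)
open import Data.Sum using (_⊎_)
open import Data.Empty using (⊥)
open import Relation.Nullary using (¬_)
open import Relation.Binary.PropositionalEquality using (_≡_; _≢_)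
open import Function.Definitions using (Injective)

-- A finite undirected graph, loops allowed, on vertex set Fin size.
record Graph : Set where
  field
    size : ℕ
    adj  : Fin size → Fin size → Bool
    adj-sym : ∀ a b → adj a b ≡ adj b a

open Graph public

V : Graph → Set
V G = Fin (size G)

Edge : (G : Graph) → V G → V G → Set
Edge G v w = T (adj G v w)

NSub : (G : Graph) → V G → V G → Set
NSub G u v = ∀ w → Edge G u w → Edge G v w

Incomparable : (G : Graph) → V G → V G → Set
Incomparable G u v = ¬ NSub G u v × ¬ NSub G v u

-- Lower bound structure of order d in H.  L is a subset of V(H) given by
-- a predicate; x, x' : Fin d → V H; a choice y ∈ {x_i,x_i'} is encoded by
-- c : Fin d → Bool (true = pick x_i').
choose : (H : Graph) {d : ℕ} → (Fin d → V H) → (Fin d → V H) → (Fin d → Bool) → Fin d → V H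
choose H x x' c i with c i
... | true  = x' i
... | false = x i

record LowerBoundStructure (H : Graph) (d : ℕ) : Set₁ where
  field
    L   : V H → Set
    x   : Fin d → V H
    x'  : Fin d → V H
    x-distinct : Injective _≡_ _≡_ x
    incomparable : ∀ i → Incomparable H (x i) (x' i)
    empty-meet : ¬ (Σ (V H) λ w → L w × (∀ i → Edge H (x i) w))
    nonempty-meet : (c : Fin d → Bool) → (Σ (Fin d) λ i → c i ≡ true) →
      Σ (V H) λ w → L w × (∀ i → Edge H (choose H x x' c i) w)

record ListHom (H : Graph) (F : Graph) (lists : V F → V H → Set) : Set where
  field
    map  : V F → V H
    edge : ∀ a b → Edge F a b → Edge H (map a) (map b)
    list : ∀ a → lists a (map a)

ListIs : {H : Graph} → (V H → Set) → V H → V H → Set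
ListIs {H} ℓ a b = ∀ z → (ℓ z → z ≡ a ⊎ z ≡ b) × (z ≡ a ⊎ z ≡ b → ℓ z)

record NEQGadget (H : Graph) (x y : V H) : Set₁ where
  field
    F     : Graph
    lists : V F → V H → Set
    u v   : V F
    list-u : ListIs {H} (lists u) x y
    list-v : ListIs {H} (lists v) x y
    φ : ListHom H F lists
    ψ : ListHom H F lists
    φ-u : ListHom.map φ u ≡ x
    φ-v : ListHom.map φ v ≡ y
    ψ-u : ListHom.map ψ u ≡ y
    ψ-v : ListHom.map ψ v ≡ x
    no-equal : (h : ListHom H F lists) → ListHom.map h u ≢ ListHom.map h v

record CompGadget (H : Graph) (a a' b b' : V H) : Set₁ where
  field
    F     : Graph
    lists : V F → V H → Set
    u v   : V F
    list-u : ListIs {H} (lists u) a a'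
    list-v : ListIs {H} (lists v) b b'
    φ : ListHom H F lists
    ψ : ListHom H F lists
    φ-u : ListHom.map φ u ≡ a
    φ-v : ListHom.map φ v ≡ b
    ψ-u : ListHom.map ψ u ≡ a'
    ψ-v : ListHom.map ψ v ≡ b'
    no-ab' : (h : ListHom H F lists) → ¬ (ListHom.map h u ≡ a × ListHom.map h v ≡ b')
    no-a'b : (h : ListHom H F lists) → ¬ (ListHom.map h u ≡ a' × ListHom.map h v ≡ b)

{-# OPTIONS --safe #-}
module Submission where

-- Flipping only the m-th coordinate of the lower bound structure gives a vertex w m ∈ L
-- adjacent to x' m and to every x n with n ≠ m, hence (the meet of all N(x n) over L
-- being empty) not adjacent to x m; incomparability gives a i adjacent to x i but not
-- to x' i.  Each gadget is a union of short paths whose vertices carry two-element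
-- lists {p, q}: taking every first entry gives φ, every second entry gives ψ.  The
-- non-edges x m ≁ w m and x' i ≁ a i let a value at an end of a path force its
-- neighbours' values, and a forbidden pair of end values forces two adjacent path
-- vertices onto a non-edge x k ≁ w k, where d ≥ 3 supplies the third index k.

open import Defs
open import Data.Nat using (ℕ; _≥_; s≤s)
open import Data.Fin using (Fin; zero; suc; #_; _≟_)
open import Data.Fin.Properties using (¬∀⟶∃¬)
open import Data.Bool using (Bool; true; false; T; _∨_)
open import Data.Bool.Properties using (∨-comm; T-∨)
open import Data.Product using (Σ; ∃-syntax; _×_; _,_; proj₁; proj₂; uncurry)
open import Data.Product.Properties using (≡-dec)
open import Data.Sum using (_⊎_; inj₁; inj₂; swap; [_,_])
open import Data.Vec using ([]; _∷_; lookup)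
open import Data.Empty using (⊥-elim)
open import Data.Unit using (tt)
open import Data.List using (List; []; _∷_)
open import Data.List.Relation.Unary.All as All using (All; []; _∷_)
import Data.List.Membership.DecPropositional as Membership
open import Function using (_∘_; id)
open import Function.Bundles using (Equivalence)
open import Relation.Nullary using (¬_; yes; no; does; contradiction)
open import Relation.Nullary.Decidable using (T?; _→-dec_; decidable-stable; toWitness; ⌊_⌋; dec-true; dec-false)
open import Relation.Binary.PropositionalEquality using (_≡_; _≢_; refl; sym; trans; subst; ≢-sym)

Edge-sym : (H : Graph) {a b : V H} → Edge H a b → Edge H b a
Edge-sym H {a} {b} = subst T (adj-sym H a b)

choose-true : (H : Graph) {d : ℕ} (x x' : Fin d → V H) (c : Fin d → Bool) (i : Fin d) →
  c i ≡ true → choose H x x' c i ≡ x' i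
choose-true H x x' c i ci≡true rewrite ci≡true = refl

choose-false : (H : Graph) {d : ℕ} (x x' : Fin d → V H) (c : Fin d → Bool) (i : Fin d) →
  c i ≡ false → choose H x x' c i ≡ x i
choose-false H x x' c i ci≡false rewrite ci≡false = refl

avoid-two : ∀ {d} → d ≥ 3 → (i j : Fin d) → ∃[ k ] k ≢ i × k ≢ j
avoid-two (s≤s (s≤s (s≤s _))) zero          zero          = # 1 , (λ ()) , (λ ())
avoid-two (s≤s (s≤s (s≤s _))) zero          (suc zero)    = # 2 , (λ ()) , (λ ())
avoid-two (s≤s (s≤s (s≤s _))) zero          (suc (suc _)) = # 1 , (λ ()) , (λ ())
avoid-two (s≤s (s≤s (s≤s _))) (suc zero)    zero          = # 2 , (λ ()) , (λ ())
avoid-two (s≤s (s≤s (s≤s _))) (suc zero)    (suc _)       = # 0 , (λ ()) , (λ ())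
avoid-two (s≤s (s≤s (s≤s _))) (suc (suc _)) zero          = # 1 , (λ ()) , (λ ())
avoid-two (s≤s (s≤s (s≤s _))) (suc (suc _)) (suc _)       = # 0 , (λ ()) , (λ ())

module _ {n : ℕ} where
  open Membership (≡-dec (_≟_ {n}) (_≟_ {n})) using (_∈?_)

  fromEdges : List (Fin n × Fin n) → Graph
  fromEdges es = record
    { size    = n
    ; adj     = λ s t → ⌊ (s , t) ∈? es ⌋ ∨ ⌊ (t , s) ∈? es ⌋
    ; adj-sym = λ s t → ∨-comm (⌊ (s , t) ∈? es ⌋) (⌊ (t , s) ∈? es ⌋)
    }

  PreservesEdges : (H : Graph) → (Fin n → V H) → List (Fin n × Fin n) → Set
  PreservesEdges H f = All (uncurry λ s t → Edge H (f s) (f t))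

  fromEdges-hom : (H : Graph) (es : List (Fin n × Fin n)) (lists : Fin n → V H → Set)
    (f : Fin n → V H) → PreservesEdges H f es → (∀ t → lists t (f t)) →
    ListHom H (fromEdges es) lists
  fromEdges-hom H es lists f f-edges f-lists = record { map = f ; edge = edge ; list = f-lists }
    where
    edge : ∀ s t → Edge (fromEdges es) s t → Edge H (f s) (f t)
    edge s t st with Equivalence.to (T-∨ {⌊ (s , t) ∈? es ⌋} {⌊ (t , s) ∈? es ⌋}) st
    ... | inj₁ st∈es = All.lookup f-edges (toWitness {a? = (s , t) ∈? es} st∈es)
    ... | inj₂ ts∈es = Edge-sym H (All.lookup f-edges (toWitness {a? = (t , s) ∈? es} ts∈es))

PairLists : (H F : Graph) → (V F → V H × V H) → V F → V H → Set
PairLists H F table t z = z ≡ proj₁ (table t) ⊎ z ≡ proj₂ (table t)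

module Forcing {H F : Graph} {table : V F → V H × V H} (h : ListHom H F (PairLists H F table)) where
  open ListHom h

  mapped-edge : ∀ {s t z₁ z₂} → Edge F s t → map s ≡ z₁ → map t ≡ z₂ → Edge H z₁ z₂
  mapped-edge {s} {t} st refl refl = edge s t st

  forced-snd : ∀ {s z} t → Edge F s t → map s ≡ z → ¬ Edge H z (proj₁ (table t)) →
    map t ≡ proj₂ (table t)
  forced-snd t st hs z≁p with list t
  ... | inj₁ ht = contradiction (mapped-edge st hs ht) z≁p
  ... | inj₂ ht = ht

  forced-fst : ∀ {s z} t → Edge F s t → map s ≡ z → ¬ Edge H z (proj₂ (table t)) →
    map t ≡ proj₁ (table t)
  forced-fst t st hs z≁q with list t
  ... | inj₁ ht = ht
  ... | inj₂ ht = contradiction (mapped-edge st hs ht) z≁q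

module Gadgets {H : Graph} {d : ℕ} (S : LowerBoundStructure H d) where
  open LowerBoundStructure S

  private
    only : Fin d → Fin d → Bool
    only m n = does (n ≟ m)

    flipped : (m : Fin d) → Σ (V H) λ z → L z × (∀ n → Edge H (choose H x x' (only m) n) z)
    flipped m = nonempty-meet (only m) (m , dec-true (m ≟ m) refl)

  w : Fin d → V H
  w m = proj₁ (flipped m)

  x'∼w : ∀ m → Edge H (x' m) (w m)
  x'∼w m = subst (λ z → Edge H z (w m)) (choose-true H x x' (only m) m (dec-true (m ≟ m) refl))
                 (proj₂ (proj₂ (flipped m)) m)

  x∼w : ∀ {n m} → n ≢ m → Edge H (x n) (w m)
  x∼w {n} {m} n≢m = subst (λ z → Edge H z (w m)) (choose-false H x x' (only m) n (dec-false (n ≟ m) n≢m))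
                          (proj₂ (proj₂ (flipped m)) n)

  x≁w : ∀ m → ¬ Edge H (x m) (w m)
  x≁w m xm∼wm = empty-meet (w m , proj₁ (proj₂ (flipped m)) , x∼wm)
    where
    x∼wm : ∀ n → Edge H (x n) (w m)
    x∼wm n with n ≟ m
    ... | yes refl = xm∼wm
    ... | no n≢m   = x∼w n≢m

  w≁x : ∀ m → ¬ Edge H (w m) (x m)
  w≁x m = x≁w m ∘ Edge-sym H

  private
    separating : (i : Fin d) → Σ (V H) λ z → ¬ (Edge H (x i) z → Edge H (x' i) z)
    separating i = ¬∀⟶∃¬ (size H) _ (λ z → T? (adj H (x i) z) →-dec T? (adj H (x' i) z))
                         (proj₁ (incomparable i))

  a : Fin d → V H
  a i = proj₁ (separating i)

  x∼a : ∀ i → Edge H (x i) (a i)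
  x∼a i = decidable-stable (T? (adj H (x i) (a i)))
            λ ¬xi∼ai → proj₂ (separating i) (⊥-elim ∘ ¬xi∼ai)

  x'≁a : ∀ i → ¬ Edge H (x' i) (a i)
  x'≁a i x'i∼ai = proj₂ (separating i) λ _ → x'i∼ai

  module Comp (i j k : Fin d) (k≢i : k ≢ i) (k≢j : k ≢ j) where
    -- Vertex 0 is u, vertex 1 is v; the paths u-2-3-4-v and u-5-6-7-v exclude (x i , x' j)
    -- and (x' i , x j) respectively, and vertices 8 and 9 are isolated padding.
    table : Fin 10 → V H × V H
    table = lookup
      ( (x i , x' i) ∷ (x j , x' j)
      ∷ (w k , w i) ∷ (x j , x k) ∷ (a j , w j)
      ∷ (a i , w i) ∷ (x i , x k) ∷ (w k , w j)
      ∷ (x i , x i) ∷ (x i , x i) ∷ [])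

    edges : List (Fin 10 × Fin 10)
    edges = (# 0 , # 2) ∷ (# 2 , # 3) ∷ (# 3 , # 4) ∷ (# 4 , # 1)
          ∷ (# 0 , # 5) ∷ (# 5 , # 6) ∷ (# 6 , # 7) ∷ (# 7 , # 1) ∷ []

    F : Graph
    F = fromEdges edges

    lists : V F → V H → Set
    lists = PairLists H F table

    φ ψ : ListHom H F lists
    φ = fromEdges-hom H edges lists (proj₁ ∘ table) φ-edges (λ _ → inj₁ refl)
      where
      φ-edges : PreservesEdges H (proj₁ ∘ table) edges
      φ-edges = x∼w (≢-sym k≢i) ∷ Edge-sym H (x∼w (≢-sym k≢j)) ∷ x∼a j ∷ Edge-sym H (x∼a j)
              ∷ x∼a i ∷ Edge-sym H (x∼a i) ∷ x∼w (≢-sym k≢i) ∷ Edge-sym H (x∼w (≢-sym k≢j)) ∷ []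
    ψ = fromEdges-hom H edges lists (proj₂ ∘ table) ψ-edges (λ _ → inj₂ refl)
      where
      ψ-edges : PreservesEdges H (proj₂ ∘ table) edges
      ψ-edges = x'∼w i ∷ Edge-sym H (x∼w k≢i) ∷ x∼w k≢j ∷ Edge-sym H (x'∼w j)
              ∷ x'∼w i ∷ Edge-sym H (x∼w k≢i) ∷ x∼w k≢j ∷ Edge-sym H (x'∼w j) ∷ []

    no-x-x' : (h : ListHom H F lists) → ¬ (ListHom.map h (# 0) ≡ x i × ListHom.map h (# 1) ≡ x' j)
    no-x-x' h (h₀ , h₁) = w≁x k (mapped-edge tt h₂ h₃)
      where
      open Forcing h
      open ListHom h using (map)
      h₂ : map (# 2) ≡ w k
      h₂ = forced-fst (# 2) tt h₀ (x≁w i)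
      h₄ : map (# 4) ≡ w j
      h₄ = forced-snd (# 4) tt h₁ (x'≁a j)
      h₃ : map (# 3) ≡ x k
      h₃ = forced-snd (# 3) tt h₄ (w≁x j)

    no-x'-x : (h : ListHom H F lists) → ¬ (ListHom.map h (# 0) ≡ x' i × ListHom.map h (# 1) ≡ x j)
    no-x'-x h (h₀ , h₁) = x≁w k (mapped-edge tt h₆ h₇)
      where
      open Forcing h
      open ListHom h using (map)
      h₅ : map (# 5) ≡ w i
      h₅ = forced-snd (# 5) tt h₀ (x'≁a i)
      h₆ : map (# 6) ≡ x k
      h₆ = forced-snd (# 6) tt h₅ (w≁x i)
      h₇ : map (# 7) ≡ w k
      h₇ = forced-fst (# 7) tt h₁ (x≁w j)

    gadget : CompGadget H (x i) (x' i) (x j) (x' j)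
    gadget = record
      { F = F ; lists = lists ; u = # 0 ; v = # 1
      ; list-u = λ _ → id , id ; list-v = λ _ → id , id
      ; φ = φ ; ψ = ψ ; φ-u = refl ; φ-v = refl ; ψ-u = refl ; ψ-v = refl
      ; no-ab' = no-x-x' ; no-a'b = no-x'-x
      }

  module NEQ (i j k : Fin d) (j≢i : j ≢ i) (k≢i : k ≢ i) (k≢j : k ≢ j) where
    -- Vertex 0 is u, vertex 1 is v; the path u-2-3-4-5-6-v excludes u = v = x' i and the
    -- path u-7-8-9-v excludes u = v = x i.
    table : Fin 10 → V H × V H
    table = lookup
      ( (x i , x' i) ∷ (x' i , x i)
      ∷ (a i , w i) ∷ (x i , x k) ∷ (w k , w j) ∷ (x j , x i) ∷ (w i , a i)
      ∷ (w j , w i) ∷ (x k , x j) ∷ (w i , w k) ∷ [])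

    edges : List (Fin 10 × Fin 10)
    edges = (# 0 , # 2) ∷ (# 2 , # 3) ∷ (# 3 , # 4) ∷ (# 4 , # 5) ∷ (# 5 , # 6) ∷ (# 6 , # 1)
          ∷ (# 0 , # 7) ∷ (# 7 , # 8) ∷ (# 8 , # 9) ∷ (# 9 , # 1) ∷ []

    F : Graph
    F = fromEdges edges

    lists : V F → V H → Set
    lists = PairLists H F table

    φ ψ : ListHom H F lists
    φ = fromEdges-hom H edges lists (proj₁ ∘ table) φ-edges (λ _ → inj₁ refl)
      where
      φ-edges : PreservesEdges H (proj₁ ∘ table) edges
      φ-edges = x∼a i ∷ Edge-sym H (x∼a i) ∷ x∼w (≢-sym k≢i) ∷ Edge-sym H (x∼w (≢-sym k≢j))
              ∷ x∼w j≢i ∷ Edge-sym H (x'∼w i)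
              ∷ x∼w (≢-sym j≢i) ∷ Edge-sym H (x∼w k≢j) ∷ x∼w k≢i ∷ Edge-sym H (x'∼w i) ∷ []
    ψ = fromEdges-hom H edges lists (proj₂ ∘ table) ψ-edges (λ _ → inj₂ refl)
      where
      ψ-edges : PreservesEdges H (proj₂ ∘ table) edges
      ψ-edges = x'∼w i ∷ Edge-sym H (x∼w k≢i) ∷ x∼w k≢j ∷ Edge-sym H (x∼w (≢-sym j≢i))
              ∷ x∼a i ∷ Edge-sym H (x∼a i)
              ∷ x'∼w i ∷ Edge-sym H (x∼w j≢i) ∷ x∼w (≢-sym k≢j) ∷ Edge-sym H (x∼w (≢-sym k≢i)) ∷ []

    no-x-x : (h : ListHom H F lists) → ¬ (ListHom.map h (# 0) ≡ x i × ListHom.map h (# 1) ≡ x i)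
    no-x-x h (h₀ , h₁) = x≁w k (mapped-edge tt h₈ h₉)
      where
      open Forcing h
      open ListHom h using (map)
      h₇ : map (# 7) ≡ w j
      h₇ = forced-fst (# 7) tt h₀ (x≁w i)
      h₈ : map (# 8) ≡ x k
      h₈ = forced-fst (# 8) tt h₇ (w≁x j)
      h₉ : map (# 9) ≡ w k
      h₉ = forced-snd (# 9) tt h₁ (x≁w i)

    no-x'-x' : (h : ListHom H F lists) → ¬ (ListHom.map h (# 0) ≡ x' i × ListHom.map h (# 1) ≡ x' i)
    no-x'-x' h (h₀ , h₁) = w≁x j (mapped-edge tt h₄ h₅)
      where
      open Forcing h
      open ListHom h using (map)
      h₂ : map (# 2) ≡ w i
      h₂ = forced-snd (# 2) tt h₀ (x'≁a i)
      h₃ : map (# 3) ≡ x k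
      h₃ = forced-snd (# 3) tt h₂ (w≁x i)
      h₄ : map (# 4) ≡ w j
      h₄ = forced-snd (# 4) tt h₃ (x≁w k)
      h₆ : map (# 6) ≡ w i
      h₆ = forced-fst (# 6) tt h₁ (x'≁a i)
      h₅ : map (# 5) ≡ x j
      h₅ = forced-fst (# 5) tt h₆ (w≁x i)

    separates : (h : ListHom H F lists) → ListHom.map h (# 0) ≢ ListHom.map h (# 1)
    separates h h₀≡h₁ =
      [ (λ h₀ → no-x-x h (h₀ , trans (sym h₀≡h₁) h₀))
      , (λ h₀ → no-x'-x' h (h₀ , trans (sym h₀≡h₁) h₀))
      ] (ListHom.list h (# 0))

    gadget : NEQGadget H (x i) (x' i)
    gadget = record
      { F = F ; lists = lists ; u = # 0 ; v = # 1
      ; list-u = λ _ → id , id ; list-v = λ _ → swap , swap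
      ; φ = φ ; ψ = ψ ; φ-u = refl ; φ-v = refl ; ψ-u = refl ; ψ-v = refl
      ; no-equal = separates
      }

lemma17 : (H : Graph) (d : ℕ) → d ≥ 3 → (S : LowerBoundStructure H d) →
    ((i : Fin d) → Σ (NEQGadget H (LowerBoundStructure.x S i) (LowerBoundStructure.x' S i))
        λ g → size (NEQGadget.F g) ≡ 10)
    × ((i j : Fin d) → i ≢ j →
        Σ (CompGadget H (LowerBoundStructure.x S i) (LowerBoundStructure.x' S i) (LowerBoundStructure.x S j) (LowerBoundStructure.x' S j))
          λ g → size (CompGadget.F g) ≡ 10)
lemma17 H d d≥3 S = neq , comp
  where
  open LowerBoundStructure S using (x; x')
  open Gadgets S using (module NEQ; module Comp)

  neq : (i : Fin d) → Σ (NEQGadget H (x i) (x' i)) λ g → size (NEQGadget.F g) ≡ 10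
  neq i =
    let (j , j≢i , _) = avoid-two d≥3 i i
        (k , k≢i , k≢j) = avoid-two d≥3 i j
    in NEQ.gadget i j k j≢i k≢i k≢j , refl

  -- The Comp construction only needs a third index, so i ≢ j goes unused.
  comp : (i j : Fin d) → i ≢ j → Σ (CompGadget H (x i) (x' i) (x j) (x' j)) λ g → size (CompGadget.F g) ≡ 10
  comp i j _ =
    let (k , k≢i , k≢j) = avoid-two d≥3 i j
    in Comp.gadget i j k k≢i k≢j , refl
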